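{- For integers $d\ge 0$ define $q^{\psi_d}(n)$, $n\ge 0$, by \[ \sum_{n=0}^{\infty} q^{\psi_d}(n)\, t^n = \frac{1}{1-\sum_{n=1}^{\infty} n^d\, t^n}. \] For $n\ge 3$ let \[ D^{\psi}(n) = \begin{cases} 2n\log_{9/8}(2), & n\equiv 0\pmod 3,\\ 2n\log_{9/8}(2) + \log_{9/8}(3) - \log_{9/8}(n+2), & n\equiv 1 \pmod 3,\\ (n+2)\log_{9/8}(2), & n\equiv 2\pmod 3,\ n\neq 5,\\ \log_{9/8}(512), & n=5. \end{cases} \] Let $n\geq 3$ and let $d > D^{\psi}(n)$. Then \[ \frac{\left(q^{\psi_d}(n)\right)^2}{q^{\psi_d}(n-1)\, q^{\psi_d}(n+1)} < 1 \quad\text{if and only if}\quad n\equiv 1\pmod 3. \]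
   Context: $\log_{9/8}$ denotes the logarithm to base $9/8$. -}

module Defs where

open import Data.Nat using (ℕ; zero; suc; _+_; _*_; _^_; _<_; _%_)
open import Data.Nat.Properties using (_≟_)
open import Data.List using (List; []; _∷_)
open import Relation.Nullary using (yes; no)

weightedSum : ℕ → ℕ → List ℕ → ℕ
weightedSum d k []       = 0
weightedSum d k (x ∷ xs) = k ^ d * x + weightedSum d (suc k) xs

-- qs d n = [ q(n), q(n-1), …, q(0) ]  where
-- Σ q(n) tⁿ = 1 / (1 - Σ_{n≥1} n^d tⁿ), i.e. q(0) = 1,
-- q(n) = Σ_{k=1}^{n} k^d q(n-k).
qs : ℕ → ℕ → List ℕ
qs d zero    = 1 ∷ []
qs d (suc n) = weightedSum d 1 (qs d n) ∷ qs d n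

headOr0 : List ℕ → ℕ
headOr0 []      = 0
headOr0 (x ∷ _) = x

qψ : ℕ → ℕ → ℕ
qψ d n = headOr0 (qs d n)

-- "d > D^ψ(n)" with logs base 9/8 exponentiated away:
-- d > log_{9/8}(X)  ⇔  (9/8)^d > X  ⇔  8^d · X < 9^d  (X > 0).
exceedsDψ : ℕ → ℕ → Set
exceedsDψ n d with n ≟ 5 | n % 3
... | yes _ | _ = 8 ^ d * 512 < 9 ^ d
... | no _ | 0 = 8 ^ d * 4 ^ n < 9 ^ d
... | no _ | 1 = 8 ^ d * (3 * 4 ^ n) < 9 ^ d * (n + 2)
... | no _ | _ = 8 ^ d * 2 ^ (n + 2) < 9 ^ d

-- Expanding 1 / (1 − Σ kᵈ tᵏ), q(n) is the sum over all compositions of n of the d-th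
-- power of the product of the parts. Let M(n) be the largest such product. A first part i
-- with i·M(n−i) < M(n) loses at least a factor (9/8)ᵈ, and there are fewer than 2ⁿ
-- compositions, so M(n)ᵈ ≤ q(n) ≤ 2ⁿ M(n)ᵈ and, more finely, q(n) ≤ (c + (8/9)ᵈ 2ⁿ) M(n)ᵈ
-- where c counts the compositions attaining M(n).
-- Since 9 M(n−1) M(n+1) = 8 M(n)² for n ≡ 0 and 9 M(n)² = 8 M(n−1) M(n+1) for n ≡ 1
-- (mod 3), the coarse bounds decide these residues once (9/8)ᵈ outweighs 4ⁿ, resp.
-- 3·4ⁿ/(n+2) (using q(n+1) ≥ ((n+2)/3) M(n+1)ᵈ). For n ≡ 2, M(n)² = M(n−1) M(n+1) and the
-- counts decide: q(n−1) q(n+1) ≤ (c(n−1) + 1/8)(1 + 1/2) M(n)²ᵈ ≤ ((n+1)/3)² M(n)²ᵈ ≤ q(n)².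

module Submission where

open import Defs
open import Data.Nat using (ℕ; zero; suc; _+_; _*_; _^_; _∸_; _%_; _≤_; _<_; _≤?_; _≟_; z≤n; s≤s; z<s; NonZero; >-nonZero)
open import Data.Nat.Properties
open import Algebra.Properties.CommutativeSemigroup *-commutativeSemigroup using (interchange) renaming (x∙yz≈y∙xz to x*[y*z]≡y*[x*z])
open import Algebra.Properties.CommutativeSemigroup +-commutativeSemigroup using () renaming (x∙yz≈y∙xz to x+[y+z]≡y+[x+z])
open import Data.Nat.DivMod using ([m+n]%n≡m%n)
open import Data.Nat.Induction using (<-rec)
open import Data.Nat.Tactic.RingSolver using (solve-∀)
open import Relation.Binary.PropositionalEquality using (_≡_; refl; sym; trans; cong; cong₂; subst; subst₂; module ≡-Reasoning)
open import Relation.Nullary using (yes; no; contradiction)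
open import Relation.Nullary.Decidable using (True; toWitness)
open import Function.Bundles using (_⇔_; mk⇔)

by-computation : ∀ {m n} {m≤n : True (m ≤? n)} → m ≤ n
by-computation {m≤n = m≤n} = toWitness m≤n

^-distribʳ-* : ∀ m n o → (m * n) ^ o ≡ m ^ o * n ^ o
^-distribʳ-* m n zero    = refl
^-distribʳ-* m n (suc o) = trans (cong ((m * n) *_) (^-distribʳ-* m n o)) (interchange m n (m ^ o) (n ^ o))

^-distribʳ-*³ : ∀ l m n o → (l * (m * n)) ^ o ≡ l ^ o * (m ^ o * n ^ o)
^-distribʳ-*³ l m n o = trans (^-distribʳ-* l (m * n) o) (cong (l ^ o *_) (^-distribʳ-* m n o))

-- M n is the largest product of the parts of a composition of n: all parts 3,
-- except for a single 2, a single 4 (or two 2's), or the lone part of n = 1.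
M : ℕ → ℕ
M 0 = 1
M 1 = 1
M 2 = 2
M 3 = 3
M 4 = 4
M (suc (suc (suc n@(suc (suc _))))) = 3 * M n

M-pos : ∀ n → 1 ≤ M n
M-pos 0 = by-computation
M-pos 1 = by-computation
M-pos 2 = by-computation
M-pos 3 = by-computation
M-pos 4 = by-computation
M-pos (suc (suc (suc n@(suc (suc _))))) = ≤-trans (M-pos n) (m≤n*m (M n) 3)

M-3+ : ∀ n → 2 ≤ n → M (3 + n) ≡ 3 * M n
M-3+ 0 ()
M-3+ 1 (s≤s ())
M-3+ (suc (suc n)) _ = refl

M-*-≤ : ∀ a b → M a * M b ≤ M (a + b)
M-*-≤ (suc (suc (suc a@(suc (suc _))))) b = ≤-trans (≤-reflexive (*-assoc 3 (M a) (M b))) (*-monoʳ-≤ 3 (M-*-≤ a b))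
M-*-≤ a (suc (suc (suc b@(suc (suc _))))) = begin
  M a * (3 * M b)     ≡⟨ x*[y*z]≡y*[x*z] (M a) 3 (M b) ⟩
  3 * (M a * M b)     ≤⟨ *-monoʳ-≤ 3 (M-*-≤ a b) ⟩
  3 * M (a + b)       ≡⟨ M-3+ (a + b) (≤-trans (s≤s (s≤s z≤n)) (m≤n+m b a)) ⟨
  M (3 + (a + b))     ≡⟨ cong M (x+[y+z]≡y+[x+z] a 3 b) ⟨
  M (a + (3 + b))     ∎
  where open ≤-Reasoning
M-*-≤ 0 b = ≤-reflexive (+-identityʳ (M b))
M-*-≤ a 0 = ≤-reflexive (trans (*-identityʳ (M a)) (cong M (sym (+-identityʳ a))))
M-*-≤ 1 1 = by-computation
M-*-≤ 1 2 = by-computation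
M-*-≤ 1 3 = by-computation
M-*-≤ 1 4 = by-computation
M-*-≤ 2 1 = by-computation
M-*-≤ 2 2 = by-computation
M-*-≤ 2 3 = by-computation
M-*-≤ 2 4 = by-computation
M-*-≤ 3 1 = by-computation
M-*-≤ 3 2 = by-computation
M-*-≤ 3 3 = by-computation
M-*-≤ 3 4 = by-computation
M-*-≤ 4 1 = by-computation
M-*-≤ 4 2 = by-computation
M-*-≤ 4 3 = by-computation
M-*-≤ 4 4 = by-computation

9*[5+k]≤8*M[5+k] : ∀ k → 9 * (5 + k) ≤ 8 * M (5 + k)
9*[5+k]≤8*M[5+k] 0 = by-computation
9*[5+k]≤8*M[5+k] 1 = by-computation
9*[5+k]≤8*M[5+k] 2 = by-computation
9*[5+k]≤8*M[5+k] (suc (suc (suc k))) = begin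
  9 * (3 + n)       ≤⟨ *-monoʳ-≤ 9 (+-monoˡ-≤ n (≤-trans (by-computation {3} {5}) (m≤m+n 5 k))) ⟩
  9 * (n + n)       ≡⟨ 9*[x+x]≡2*[9*x] n ⟩
  2 * (9 * n)       ≤⟨ *-monoʳ-≤ 2 (9*[5+k]≤8*M[5+k] k) ⟩
  2 * (8 * M n)     ≤⟨ *-monoˡ-≤ (8 * M n) (by-computation {2} {3}) ⟩
  3 * (8 * M n)     ≡⟨ x*[y*z]≡y*[x*z] 3 8 (M n) ⟩
  8 * (3 * M n)     ∎
  where
  open ≤-Reasoning
  n = 5 + k
  9*[x+x]≡2*[9*x] : ∀ x → 9 * (x + x) ≡ 2 * (9 * x)
  9*[x+x]≡2*[9*x] = solve-∀

n≤M[n] : ∀ n → n ≤ M n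
n≤M[n] 0 = z≤n
n≤M[n] 1 = by-computation
n≤M[n] 2 = by-computation
n≤M[n] 3 = by-computation
n≤M[n] 4 = by-computation
n≤M[n] (suc (suc (suc (suc (suc k))))) =
  *-cancelˡ-≤ 9 (≤-trans (9*[5+k]≤8*M[5+k] k) (*-monoˡ-≤ (M (5 + k)) (by-computation {8} {9})))

i*M[j]≤M[i+j] : ∀ i j → i * M j ≤ M (i + j)
i*M[j]≤M[i+j] i j = ≤-trans (*-monoˡ-≤ (M j) (n≤M[n] i)) (M-*-≤ i j)

-- The factor 9/8 lost by a non-optimal first part is the base of the logarithms in D^ψ.
record Lossy (i j N : ℕ) : Set where
  constructor lossy
  field 9*[i*M[j]]≤8*M[N] : 9 * (i * M j) ≤ 8 * M N

record Optimal (i j N : ℕ) : Set where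
  constructor optimal
  field i*M[j]≡M[N] : i * M j ≡ M N

lossy-5+k : ∀ k j → Lossy (5 + k) j (5 + k + j)
lossy-5+k k j = lossy (begin
  9 * ((5 + k) * M j)     ≡⟨ *-assoc 9 (5 + k) (M j) ⟨
  9 * (5 + k) * M j       ≤⟨ *-monoˡ-≤ (M j) (9*[5+k]≤8*M[5+k] k) ⟩
  8 * M (5 + k) * M j     ≡⟨ *-assoc 8 (M (5 + k)) (M j) ⟩
  8 * (M (5 + k) * M j)   ≤⟨ *-monoʳ-≤ 8 (M-*-≤ (5 + k) j) ⟩
  8 * M (5 + k + j)       ∎)
  where open ≤-Reasoning

lossy-≥5 : ∀ {i N} → 5 ≤ i → i ≤ N → Lossy i (N ∸ i) N
lossy-≥5 {N = N} (s≤s (s≤s (s≤s (s≤s (s≤s (z≤n {k})))))) i≤N =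
  subst (Lossy (5 + k) (N ∸ (5 + k))) (m+[n∸m]≡n i≤N) (lossy-5+k k (N ∸ (5 + k)))

-- 3 * m, defined so that e.g. 5 + triple (suc m) reduces to 8 + triple m.
triple : ℕ → ℕ
triple zero    = zero
triple (suc m) = 3 + triple m

triple≡3* : ∀ m → triple m ≡ 3 * m
triple≡3* zero    = refl
triple≡3* (suc m) = trans (cong (3 +_) (triple≡3* m)) (sym (*-suc 3 m))

[r+triple]%3≡r%3 : ∀ r m → (r + triple m) % 3 ≡ r % 3
[r+triple]%3≡r%3 r zero    = cong (_% 3) (+-identityʳ r)
[r+triple]%3≡r%3 r (suc m) = begin
  (r + (3 + triple m)) % 3   ≡⟨ cong (λ x → (r + x) % 3) (+-comm 3 (triple m)) ⟩
  (r + (triple m + 3)) % 3   ≡⟨ cong (_% 3) (+-assoc r (triple m) 3) ⟨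
  (r + triple m + 3) % 3     ≡⟨ [m+n]%n≡m%n (r + triple m) 3 ⟩
  (r + triple m) % 3         ≡⟨ [r+triple]%3≡r%3 r m ⟩
  r % 3                      ∎
  where open ≡-Reasoning

M-periodic : ∀ k m → M (2 + k + triple m) ≡ 3 ^ m * M (2 + k)
M-periodic k zero    = trans (cong M (+-identityʳ (2 + k))) (sym (*-identityˡ (M (2 + k))))
M-periodic k (suc m) = begin
  M (2 + k + (3 + triple m))    ≡⟨ cong M (x+[y+z]≡y+[x+z] (2 + k) 3 (triple m)) ⟩
  3 * M (2 + k + triple m)      ≡⟨ cong (3 *_) (M-periodic k m) ⟩
  3 * (3 ^ m * M (2 + k))       ≡⟨ *-assoc 3 (3 ^ m) (M (2 + k)) ⟨
  3 ^ suc m * M (2 + k)         ∎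
  where open ≡-Reasoning

lossy-periodic : ∀ {i} j N m → Lossy i (2 + j) (2 + N) → Lossy i (2 + j + triple m) (2 + N + triple m)
lossy-periodic {i} j N m (lossy 9*[i*M[j]]≤8*M[N]) = lossy (begin
  9 * (i * M (2 + j + triple m))    ≡⟨ cong (λ x → 9 * (i * x)) (M-periodic j m) ⟩
  9 * (i * (3 ^ m * M (2 + j)))     ≡⟨ a*[b*[c*x]]≡c*[a*[b*x]] 9 i (3 ^ m) (M (2 + j)) ⟩
  3 ^ m * (9 * (i * M (2 + j)))     ≤⟨ *-monoʳ-≤ (3 ^ m) 9*[i*M[j]]≤8*M[N] ⟩
  3 ^ m * (8 * M (2 + N))           ≡⟨ x*[y*z]≡y*[x*z] (3 ^ m) 8 (M (2 + N)) ⟩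
  8 * (3 ^ m * M (2 + N))           ≡⟨ cong (8 *_) (M-periodic N m) ⟨
  8 * M (2 + N + triple m)          ∎)
  where
  open ≤-Reasoning
  a*[b*[c*x]]≡c*[a*[b*x]] : ∀ a b c x → a * (b * (c * x)) ≡ c * (a * (b * x))
  a*[b*[c*x]]≡c*[a*[b*x]] = solve-∀

optimal-periodic : ∀ {i} j N m → Optimal i (2 + j) (2 + N) → Optimal i (2 + j + triple m) (2 + N + triple m)
optimal-periodic {i} j N m (optimal i*M[j]≡M[N]) = optimal (begin
  i * M (2 + j + triple m)     ≡⟨ cong (i *_) (M-periodic j m) ⟩
  i * (3 ^ m * M (2 + j))      ≡⟨ x*[y*z]≡y*[x*z] i (3 ^ m) (M (2 + j)) ⟩
  3 ^ m * (i * M (2 + j))      ≡⟨ cong (3 ^ m *_) i*M[j]≡M[N] ⟩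
  3 ^ m * M (2 + N)            ≡⟨ M-periodic N m ⟨
  M (2 + N + triple m)         ∎)
  where open ≡-Reasoning

M*M-periodic : ∀ {a b} i j k l m → a * (M (2 + i) * M (2 + j)) ≡ b * (M (2 + k) * M (2 + l)) →
  a * (M (2 + i + triple m) * M (2 + j + triple m)) ≡ b * (M (2 + k + triple m) * M (2 + l + triple m))
M*M-periodic {a} {b} i j k l m eq = begin
  a * (M (2 + i + triple m) * M (2 + j + triple m))     ≡⟨ cong₂ (λ x y → a * (x * y)) (M-periodic i m) (M-periodic j m) ⟩
  a * ((s * M (2 + i)) * (s * M (2 + j)))               ≡⟨ scale a s (M (2 + i)) (M (2 + j)) ⟩
  (s * s) * (a * (M (2 + i) * M (2 + j)))               ≡⟨ cong ((s * s) *_) eq ⟩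
  (s * s) * (b * (M (2 + k) * M (2 + l)))               ≡⟨ scale b s (M (2 + k)) (M (2 + l)) ⟨
  b * ((s * M (2 + k)) * (s * M (2 + l)))               ≡⟨ cong₂ (λ x y → b * (x * y)) (M-periodic k m) (M-periodic l m) ⟨
  b * (M (2 + k + triple m) * M (2 + l + triple m))     ∎
  where
  open ≡-Reasoning
  s = 3 ^ m
  scale : ∀ a s x y → a * ((s * x) * (s * y)) ≡ (s * s) * (a * (x * y))
  scale = solve-∀

sumFrom : ℕ → ℕ → (ℕ → ℕ) → ℕ
sumFrom k zero    f = 0
sumFrom k (suc m) f = f k + sumFrom (suc k) m f

sumFrom-mono-≤ : ∀ k m {f g : ℕ → ℕ} → (∀ i → k ≤ i → i < k + m → f i ≤ g i) → sumFrom k m f ≤ sumFrom k m g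
sumFrom-mono-≤ k zero    f≤g = z≤n
sumFrom-mono-≤ k (suc m) f≤g = +-mono-≤ (f≤g k ≤-refl (m<m+n k z<s))
  (sumFrom-mono-≤ (suc k) m (λ i k<i i<k+m → f≤g i (<⇒≤ k<i) (≤-trans i<k+m (≤-reflexive (sym (+-suc k m))))))

sumFrom-*ʳ : ∀ k m (f : ℕ → ℕ) x → sumFrom k m (λ i → f i * x) ≡ sumFrom k m f * x
sumFrom-*ʳ k zero    f x = refl
sumFrom-*ʳ k (suc m) f x =
  trans (cong (f k * x +_) (sumFrom-*ʳ (suc k) m f x)) (sym (*-distribʳ-+ x (f k) (sumFrom (suc k) m f)))

term≤sumFrom : ∀ k m (f : ℕ → ℕ) i → k ≤ i → i < k + m → f i ≤ sumFrom k m f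
term≤sumFrom k zero f i k≤i i<k+0 = contradiction (≤-trans i<k+0 (≤-reflexive (+-identityʳ k))) (≤⇒≯ k≤i)
term≤sumFrom k (suc m) f i k≤i i<k+m with k ≟ i
... | yes refl = m≤m+n (f k) _
... | no k≢i   = ≤-trans (term≤sumFrom (suc k) m f i (≤∧≢⇒< k≤i k≢i) (≤-trans i<k+m (≤-reflexive (+-suc k m))))
                         (m≤n+m _ (f k))

sumFrom-2^[N∸i]<2^[1+m] : ∀ k m {N} → k + m ≡ N → sumFrom k (suc m) (λ i → 2 ^ (N ∸ i)) < 2 ^ suc m
sumFrom-2^[N∸i]<2^[1+m] k zero    refl = ≤-reflexive (cong (λ e → suc (2 ^ e + 0)) (m+n∸m≡n k 0))
sumFrom-2^[N∸i]<2^[1+m] k (suc m) refl = begin-strict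
  2 ^ (N ∸ k) + sumFrom (suc k) (suc m) (λ i → 2 ^ (N ∸ i))   <⟨ +-monoʳ-< (2 ^ (N ∸ k)) (sumFrom-2^[N∸i]<2^[1+m] (suc k) m (sym (+-suc k m))) ⟩
  2 ^ (N ∸ k) + 2 ^ suc m                                     ≡⟨ cong (λ e → 2 ^ e + 2 ^ suc m) (m+n∸m≡n k (suc m)) ⟩
  2 ^ suc m + 2 ^ suc m                                       ≡⟨ cong (2 ^ suc m +_) (+-identityʳ (2 ^ suc m)) ⟨
  2 ^ suc (suc m)                                             ∎
  where
  open ≤-Reasoning
  N = k + suc m

-- The number of compositions of 4 + 3m with product of parts M (4 + 3m):
-- m 3's and a 4, or m 3's and two 2's.
count₁ : ℕ → ℕ
count₁ zero    = 2
count₁ (suc m) = (2 + m) + (count₁ m + 1)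

count₁-bound : ∀ m → 3 * (8 * count₁ m + 1) ≤ 16 * ((2 + m) * (2 + m))
count₁-bound zero    = by-computation
count₁-bound (suc m) = begin
  3 * (8 * count₁ (suc m) + 1)                     ≡⟨ unfold (count₁ m) m ⟩
  3 * (8 * count₁ m + 1) + (24 * m + 72)           ≤⟨ +-mono-≤ (count₁-bound m) (+-mono-≤ (*-monoˡ-≤ m (by-computation {24} {32})) (by-computation {72} {80})) ⟩
  16 * ((2 + m) * (2 + m)) + (32 * m + 80)         ≡⟨ square m ⟩
  16 * ((3 + m) * (3 + m))                         ∎
  where
  open ≤-Reasoning
  unfold : ∀ c m → 3 * (8 * ((2 + m) + (c + 1)) + 1) ≡ 3 * (8 * c + 1) + (24 * m + 72)
  unfold = solve-∀
  square : ∀ m → 16 * ((2 + m) * (2 + m)) + (32 * m + 80) ≡ 16 * ((3 + m) * (3 + m))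
  square = solve-∀

2^k*2^[2+k]≡4^[1+k] : ∀ k → 2 ^ k * 2 ^ (2 + k) ≡ 4 ^ (1 + k)
2^k*2^[2+k]≡4^[1+k] k = trans (regroup (2 ^ k)) (sym (^-distribʳ-* 2 2 (1 + k)))
  where
  regroup : ∀ x → x * (2 * (2 * x)) ≡ (2 * x) * (2 * x)
  regroup = solve-∀

module Estimates (d : ℕ) where

  q : ℕ → ℕ
  q = qψ d

  term : ℕ → ℕ → ℕ
  term N i = i ^ d * q (N ∸ i)

  q-unfold : ∀ n → q (suc n) ≡ sumFrom 1 (suc n) (term (suc n))
  q-unfold n = weightedSum≡sumFrom n 1 refl
    where
    weightedSum≡sumFrom : ∀ m k {N} → k + m ≡ N → weightedSum d k (qs d m) ≡ sumFrom k (suc m) (term N)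
    weightedSum≡sumFrom zero    k refl = cong (λ j → k ^ d * q j + 0) (sym (m+n∸m≡n k 0))
    weightedSum≡sumFrom (suc m) k refl =
      cong₂ _+_ (cong (λ j → k ^ d * q j) (sym (m+n∸m≡n k (suc m)))) (weightedSum≡sumFrom m (suc k) (sym (+-suc k m)))

  term≤q : ∀ i j → suc i ^ d * q j ≤ q (suc i + j)
  term≤q i j = begin
    suc i ^ d * q j                               ≡⟨ cong (λ x → suc i ^ d * q x) (m+n∸m≡n i j) ⟨
    term (suc i + j) (suc i)                      ≤⟨ term≤sumFrom 1 (suc (i + j)) (term (suc i + j)) (suc i) (s≤s z≤n) (s≤s (s≤s (m≤m+n i j))) ⟩
    sumFrom 1 (suc (i + j)) (term (suc i + j))    ≡⟨ q-unfold (i + j) ⟨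
    q (suc i + j)                                 ∎
    where open ≤-Reasoning

  M^d≤q : ∀ N → M N ^ d ≤ q N
  M^d≤q 0 = ≤-reflexive (^-zeroˡ d)
  M^d≤q 1 = ≤-trans (≤-reflexive (sym (*-identityʳ (1 ^ d)))) (term≤q 0 0)
  M^d≤q 2 = ≤-trans (≤-reflexive (sym (*-identityʳ (2 ^ d)))) (term≤q 1 0)
  M^d≤q 3 = ≤-trans (≤-reflexive (sym (*-identityʳ (3 ^ d)))) (term≤q 2 0)
  M^d≤q 4 = ≤-trans (≤-reflexive (sym (*-identityʳ (4 ^ d)))) (term≤q 3 0)
  M^d≤q (suc (suc (suc n@(suc (suc _))))) = begin
    (3 * M n) ^ d     ≡⟨ ^-distribʳ-* 3 (M n) d ⟩
    3 ^ d * M n ^ d   ≤⟨ *-monoʳ-≤ (3 ^ d) (M^d≤q n) ⟩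
    3 ^ d * q n       ≤⟨ term≤q 2 n ⟩
    q (3 + n)         ∎
    where open ≤-Reasoning

  q≤2^N*M[N]^d : ∀ N → q N ≤ 2 ^ N * M N ^ d
  q≤2^N*M[N]^d = <-rec _ bound
    where
    bound : ∀ N → (∀ {j} → j < N → q j ≤ 2 ^ j * M j ^ d) → q N ≤ 2 ^ N * M N ^ d
    bound zero    _  = ≤-reflexive (sym (trans (*-identityˡ (1 ^ d)) (^-zeroˡ d)))
    bound (suc n) IH = begin
      q N                                       ≡⟨ q-unfold n ⟩
      sumFrom 1 N (term N)                      ≤⟨ sumFrom-mono-≤ 1 N term≤ ⟩
      sumFrom 1 N (λ i → 2 ^ (N ∸ i) * X)       ≡⟨ sumFrom-*ʳ 1 N (λ i → 2 ^ (N ∸ i)) X ⟩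
      sumFrom 1 N (λ i → 2 ^ (N ∸ i)) * X       ≤⟨ *-monoˡ-≤ X (<⇒≤ (sumFrom-2^[N∸i]<2^[1+m] 1 n refl)) ⟩
      2 ^ N * X                                 ∎
      where
      open ≤-Reasoning
      N = suc n
      X = M N ^ d
      term≤ : ∀ i → 1 ≤ i → i < 1 + N → term N i ≤ 2 ^ (N ∸ i) * X
      term≤ i 1≤i i<1+N = begin
        i ^ d * q (N ∸ i)                          ≤⟨ *-monoʳ-≤ (i ^ d) (IH (∸-monoʳ-< 1≤i i≤N)) ⟩
        i ^ d * (2 ^ (N ∸ i) * M (N ∸ i) ^ d)      ≡⟨ x*[y*z]≡y*[x*z] (i ^ d) (2 ^ (N ∸ i)) (M (N ∸ i) ^ d) ⟩
        2 ^ (N ∸ i) * (i ^ d * M (N ∸ i) ^ d)      ≡⟨ cong (2 ^ (N ∸ i) *_) (^-distribʳ-* i (M (N ∸ i)) d) ⟨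
        2 ^ (N ∸ i) * (i * M (N ∸ i)) ^ d          ≤⟨ *-monoʳ-≤ (2 ^ (N ∸ i)) (^-monoˡ-≤ d i*M[N∸i]≤M[N]) ⟩
        2 ^ (N ∸ i) * X                            ∎
        where
        i≤N = ≤-pred i<1+N
        i*M[N∸i]≤M[N] : i * M (N ∸ i) ≤ M N
        i*M[N∸i]≤M[N] = ≤-trans (i*M[j]≤M[i+j] i (N ∸ i)) (≤-reflexive (cong M (m+[n∸m]≡n i≤N)))

  infix 4 _≤[_,_]_

  -- x ≤[ c , e ] X  says  x ≤ (c + (8/9)ᵈ e) X, with the denominator cleared.
  _≤[_,_]_ : ℕ → ℕ → ℕ → ℕ → Set
  x ≤[ c , e ] X = 9 ^ d * x ≤ (9 ^ d * c + 8 ^ d * e) * X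

  0≤[0,0] : ∀ {X} → 0 ≤[ 0 , 0 ] X
  0≤[0,0] = ≤-trans (≤-reflexive (*-zeroʳ (9 ^ d))) z≤n

  ≤[]-+ : ∀ {x y c₁ c₂ e₁ e₂ X} → x ≤[ c₁ , e₁ ] X → y ≤[ c₂ , e₂ ] X → x + y ≤[ c₁ + c₂ , e₁ + e₂ ] X
  ≤[]-+ {x} {y} {c₁} {c₂} {e₁} {e₂} {X} x≤ y≤ = begin
    9 ^ d * (x + y)                                                    ≡⟨ *-distribˡ-+ (9 ^ d) x y ⟩
    9 ^ d * x + 9 ^ d * y                                              ≤⟨ +-mono-≤ x≤ y≤ ⟩
    (9 ^ d * c₁ + 8 ^ d * e₁) * X + (9 ^ d * c₂ + 8 ^ d * e₂) * X      ≡⟨ collect (9 ^ d) (8 ^ d) c₁ c₂ e₁ e₂ X ⟩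
    (9 ^ d * (c₁ + c₂) + 8 ^ d * (e₁ + e₂)) * X                        ∎
    where
    open ≤-Reasoning
    collect : ∀ B A c₁ c₂ e₁ e₂ X → (B * c₁ + A * e₁) * X + (B * c₂ + A * e₂) * X ≡ (B * (c₁ + c₂) + A * (e₁ + e₂)) * X
    collect = solve-∀

  ≤[]-monoᵉ : ∀ {x c e₁ e₂ X} → e₁ ≤ e₂ → x ≤[ c , e₁ ] X → x ≤[ c , e₂ ] X
  ≤[]-monoᵉ {c = c} {X = X} e₁≤e₂ x≤ = ≤-trans x≤ (*-monoˡ-≤ X (+-monoʳ-≤ (9 ^ d * c) (*-monoʳ-≤ (8 ^ d) e₁≤e₂)))

  ≤[]-*ˡ : ∀ k {x c e X} → x ≤[ c , e ] X → k * x ≤[ c , e ] k * X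
  ≤[]-*ˡ k {x} {c} {e} {X} x≤ = begin
    9 ^ d * (k * x)        ≡⟨ x*[y*z]≡y*[x*z] (9 ^ d) k x ⟩
    k * (9 ^ d * x)        ≤⟨ *-monoʳ-≤ k x≤ ⟩
    k * (C * X)            ≡⟨ x*[y*z]≡y*[x*z] k C X ⟩
    C * (k * X)            ∎
    where
    open ≤-Reasoning
    C = 9 ^ d * c + 8 ^ d * e

  q0≤[1,1] : q 0 ≤[ 1 , 1 ] M 0 ^ d
  q0≤[1,1] = begin
    9 ^ d * 1                          ≤⟨ m≤m+n (9 ^ d * 1) (8 ^ d * 1) ⟩
    9 ^ d * 1 + 8 ^ d * 1              ≡⟨ *-identityʳ _ ⟨
    (9 ^ d * 1 + 8 ^ d * 1) * 1        ≡⟨ cong ((9 ^ d * 1 + 8 ^ d * 1) *_) (^-zeroˡ d) ⟨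
    (9 ^ d * 1 + 8 ^ d * 1) * 1 ^ d    ∎
    where open ≤-Reasoning

  lossy-term : ∀ {i j N} → Lossy i j N → i ^ d * q j ≤[ 0 , 2 ^ j ] M N ^ d
  lossy-term {i} {j} {N} (lossy 9*[i*M[j]]≤8*M[N]) = begin
    9 ^ d * (i ^ d * q j)                          ≤⟨ *-monoʳ-≤ (9 ^ d) (*-monoʳ-≤ (i ^ d) (q≤2^N*M[N]^d j)) ⟩
    9 ^ d * (i ^ d * (2 ^ j * M j ^ d))            ≡⟨ regroup (9 ^ d) (i ^ d) (2 ^ j) (M j ^ d) ⟩
    2 ^ j * (9 ^ d * (i ^ d * M j ^ d))            ≡⟨ cong (2 ^ j *_) (^-distribʳ-*³ 9 i (M j) d) ⟨
    2 ^ j * (9 * (i * M j)) ^ d                    ≤⟨ *-monoʳ-≤ (2 ^ j) (^-monoˡ-≤ d 9*[i*M[j]]≤8*M[N]) ⟩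
    2 ^ j * (8 * M N) ^ d                          ≡⟨ cong (2 ^ j *_) (^-distribʳ-* 8 (M N) d) ⟩
    2 ^ j * (8 ^ d * M N ^ d)                      ≡⟨ regroup′ (9 ^ d) (8 ^ d) (2 ^ j) (M N ^ d) ⟩
    (9 ^ d * 0 + 8 ^ d * 2 ^ j) * M N ^ d          ∎
    where
    open ≤-Reasoning
    regroup : ∀ B I E Y → B * (I * (E * Y)) ≡ E * (B * (I * Y))
    regroup = solve-∀
    regroup′ : ∀ B A E Y → E * (A * Y) ≡ (B * 0 + A * E) * Y
    regroup′ = solve-∀

  optimal-term : ∀ {i j N c e} → Optimal i j N → q j ≤[ c , e ] M j ^ d → i ^ d * q j ≤[ c , e ] M N ^ d
  optimal-term {i} {j} {N} {c} {e} (optimal i*M[j]≡M[N]) q≤ = subst (i ^ d * q j ≤[ c , e ]_) i^d*M[j]^d≡M[N]^d (≤[]-*ˡ (i ^ d) q≤)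
    where
    i^d*M[j]^d≡M[N]^d : i ^ d * M j ^ d ≡ M N ^ d
    i^d*M[j]^d≡M[N]^d = trans (sym (^-distribʳ-* i (M j) d)) (cong (_^ d) i*M[j]≡M[N])

  q-≤[] : ∀ n {c X} → sumFrom 1 (suc n) (term (suc n)) ≤[ c , sumFrom 1 (suc n) (λ i → 2 ^ (suc n ∸ i)) ] X →
          q (suc n) ≤[ c , 2 ^ suc n ] X
  q-≤[] n {c} {X} terms≤ =
    subst (_≤[ c , 2 ^ suc n ] X) (sym (q-unfold n)) (≤[]-monoᵉ (<⇒≤ (sumFrom-2^[N∸i]<2^[1+m] 1 n refl)) terms≤)

  tail≤[] : ∀ k m {N} → 5 ≤ k → k + m ≤ suc N → sumFrom k m (term N) ≤[ 0 , sumFrom k m (λ i → 2 ^ (N ∸ i)) ] M N ^ d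
  tail≤[] k zero    _   _       = 0≤[0,0]
  tail≤[] k (suc m) {N} 5≤k k+m≤N =
    ≤[]-+ (lossy-term (lossy-≥5 5≤k k≤N)) (tail≤[] (suc k) m (≤-trans 5≤k (n≤1+n k)) (≤-trans (≤-reflexive (sym (+-suc k m))) k+m≤N))
    where
    k≤N : k ≤ N
    k≤N = ≤-pred (≤-trans (s≤s (m≤m+n k m)) (≤-trans (≤-reflexive (sym (+-suc k m))) k+m≤N))

  q-≤[]-4+k : ∀ k {c₁ c₂ c₃ c₄} → let N = 4 + k in
    term N 1 ≤[ c₁ , 2 ^ (N ∸ 1) ] M N ^ d → term N 2 ≤[ c₂ , 2 ^ (N ∸ 2) ] M N ^ d →
    term N 3 ≤[ c₃ , 2 ^ (N ∸ 3) ] M N ^ d → term N 4 ≤[ c₄ , 2 ^ (N ∸ 4) ] M N ^ d →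
    q N ≤[ c₁ + (c₂ + (c₃ + c₄)) , 2 ^ N ] M N ^ d
  q-≤[]-4+k k {c₁} {c₂} {c₃} {c₄} t₁ t₂ t₃ t₄ =
    q-≤[] (3 + k) (subst (λ c → _ ≤[ c₁ + (c₂ + (c₃ + c)) , _ ] _) (+-identityʳ c₄)
      (≤[]-+ t₁ (≤[]-+ t₂ (≤[]-+ t₃ (≤[]-+ t₄ (tail≤[] 5 k ≤-refl ≤-refl))))))

  q-≤[]-3+3m : ∀ m → q (3 + triple m) ≤[ 1 , 2 ^ (3 + triple m) ] M (3 + triple m) ^ d
  q-≤[]-2+3m : ∀ m → q (2 + triple m) ≤[ suc m , 2 ^ (2 + triple m) ] M (2 + triple m) ^ d
  q-≤[]-4+3m : ∀ m → q (4 + triple m) ≤[ count₁ m , 2 ^ (4 + triple m) ] M (4 + triple m) ^ d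

  q-≤[]-3+3m zero = q-≤[] 2
    (≤[]-+ (lossy-term (lossy {1} {2} {3} by-computation))
    (≤[]-+ (lossy-term (lossy {2} {1} {3} by-computation))
    (≤[]-+ (optimal-term (optimal {3} {0} {3} refl) q0≤[1,1])
           0≤[0,0])))
  q-≤[]-3+3m (suc m) = q-≤[]-4+k (2 + triple m)
    (lossy-term (lossy-periodic 3 4 m (lossy by-computation)))
    (lossy-term (lossy-periodic 2 4 m (lossy by-computation)))
    (optimal-term (optimal-periodic 1 4 m (optimal refl)) (q-≤[]-3+3m m))
    (lossy-term (lossy-periodic 0 4 m (lossy by-computation)))

  q-≤[]-2+3m zero = q-≤[] 1
    (≤[]-+ (lossy-term (lossy {1} {1} {2} by-computation))
    (≤[]-+ (optimal-term (optimal {2} {0} {2} refl) q0≤[1,1])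
           0≤[0,0]))
  q-≤[]-2+3m (suc m) = subst (λ c → q N ≤[ c , 2 ^ N ] M N ^ d) (cong (2 +_) (+-identityʳ m)) (q-≤[]-4+k (1 + triple m)
    (lossy-term (lossy-periodic 2 3 m (lossy by-computation)))
    (optimal-term (optimal-periodic 1 3 m (optimal refl)) (q-≤[]-3+3m m))
    (optimal-term (optimal-periodic 0 3 m (optimal refl)) (q-≤[]-2+3m m))
    (lossy-term (lossy-4-[1+3m] m)))
    where
    N = 5 + triple m
    lossy-4-[1+3m] : ∀ m → Lossy 4 (1 + triple m) (5 + triple m)
    lossy-4-[1+3m] zero    = lossy by-computation
    lossy-4-[1+3m] (suc m) = lossy-periodic 2 6 m (lossy by-computation)

  q-≤[]-4+3m zero = q-≤[]-4+k 0
    (lossy-term (lossy {1} {3} {4} by-computation))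
    (optimal-term (optimal {2} {2} {4} refl) (q-≤[]-2+3m 0))
    (lossy-term (lossy {3} {1} {4} by-computation))
    (optimal-term (optimal {4} {0} {4} refl) q0≤[1,1])
  q-≤[]-4+3m (suc m) = q-≤[]-4+k (3 + triple m)
    (lossy-term (lossy-periodic 4 5 m (lossy by-computation)))
    (optimal-term (optimal-periodic 3 5 m (optimal refl)) (q-≤[]-2+3m (suc m)))
    (optimal-term (optimal-periodic 2 5 m (optimal refl)) (q-≤[]-4+3m m))
    (optimal-term (optimal-periodic 1 5 m (optimal refl)) (q-≤[]-3+3m m))

  instance
    9^d≢0 : NonZero (9 ^ d)
    9^d≢0 = m^n≢0 9 d

  ≤[]-absorb : ∀ k {x c e X} → x ≤[ c , e ] X → 8 ^ d * (k * e) ≤ 9 ^ d → k * x ≤ (k * c + 1) * X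
  ≤[]-absorb k {x} {c} {e} {X} x≤ 8^d*[k*e]≤9^d = *-cancelˡ-≤ (9 ^ d) (begin
    9 ^ d * (k * x)                                ≡⟨ x*[y*z]≡y*[x*z] (9 ^ d) k x ⟩
    k * (9 ^ d * x)                                ≤⟨ *-monoʳ-≤ k x≤ ⟩
    k * ((9 ^ d * c + 8 ^ d * e) * X)              ≡⟨ distribute k (9 ^ d) (8 ^ d) c e X ⟩
    (9 ^ d * (k * c) + 8 ^ d * (k * e)) * X        ≤⟨ *-monoˡ-≤ X (+-monoʳ-≤ (9 ^ d * (k * c)) 8^d*[k*e]≤9^d) ⟩
    (9 ^ d * (k * c) + 9 ^ d) * X                  ≡⟨ factor (9 ^ d) (k * c) X ⟩
    9 ^ d * ((k * c + 1) * X)                      ∎)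
    where
    open ≤-Reasoning
    distribute : ∀ k B A c e X → k * ((B * c + A * e) * X) ≡ (B * (k * c) + A * (k * e)) * X
    distribute = solve-∀
    factor : ∀ B y X → (B * y + B) * X ≡ B * ((y + 1) * X)
    factor = solve-∀

  q-lower-2+3m : ∀ m → suc m * M (2 + triple m) ^ d ≤ q (2 + triple m)
  q-lower-2+3m zero    = ≤-trans (≤-reflexive (*-identityˡ (M 2 ^ d))) (M^d≤q 2)
  q-lower-2+3m (suc m) = begin
    (2 + m) * M N ^ d                             ≡⟨ split (M N ^ d) m ⟩
    M N ^ d + (1 + m) * (3 * M (2 + t)) ^ d       ≡⟨ cong (λ x → x ^ d + (1 + m) * (3 * M (2 + t)) ^ d) (sym (Optimal.i*M[j]≡M[N] optimal₂)) ⟩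
    (2 * M (3 + t)) ^ d + (1 + m) * (3 * M (2 + t)) ^ d
        ≡⟨ cong₂ _+_ (^-distribʳ-* 2 (M (3 + t)) d) (cong ((1 + m) *_) (^-distribʳ-* 3 (M (2 + t)) d)) ⟩
    2 ^ d * M (3 + t) ^ d + (1 + m) * (3 ^ d * M (2 + t) ^ d)
        ≡⟨ cong (2 ^ d * M (3 + t) ^ d +_) (x*[y*z]≡y*[x*z] (1 + m) (3 ^ d) (M (2 + t) ^ d)) ⟩
    2 ^ d * M (3 + t) ^ d + 3 ^ d * ((1 + m) * M (2 + t) ^ d)
        ≤⟨ +-mono-≤ (*-monoʳ-≤ (2 ^ d) (M^d≤q (3 + t))) (*-monoʳ-≤ (3 ^ d) (q-lower-2+3m m)) ⟩
    term N 2 + term N 3                           ≤⟨ +-monoʳ-≤ (term N 2) (m≤m+n (term N 3) _) ⟩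
    term N 2 + (term N 3 + _)                     ≤⟨ m≤n+m _ (term N 1) ⟩
    sumFrom 1 N (term N)                          ≡⟨ q-unfold (4 + t) ⟨
    q N                                           ∎
    where
    open ≤-Reasoning
    t = triple m
    N = 5 + t
    optimal₂ : Optimal 2 (3 + t) (5 + t)
    optimal₂ = optimal-periodic 1 3 m (optimal refl)
    split : ∀ X m → (2 + m) * X ≡ X + (1 + m) * X
    split = solve-∀

  q*q<q*q : ∀ a b c e k → 9 * (M a * M b) ≡ 8 * (M c * M e) → 8 ^ d * (2 ^ a * 2 ^ b) < 9 ^ d * k →
            k * (M c * M e) ^ d ≤ q c * q e → q a * q b < q c * q e
  q*q<q*q a b c e k 9*M*M≡8*M*M 8^d*2^a*2^b<9^d*k lower = *-cancelˡ-< (9 ^ d) _ _ (begin-strict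
    9 ^ d * (q a * q b)                                 ≤⟨ *-monoʳ-≤ (9 ^ d) (*-mono-≤ (q≤2^N*M[N]^d a) (q≤2^N*M[N]^d b)) ⟩
    9 ^ d * ((2 ^ a * M a ^ d) * (2 ^ b * M b ^ d))     ≡⟨ regroup (9 ^ d) (2 ^ a) (2 ^ b) (M a ^ d) (M b ^ d) ⟩
    E * (9 ^ d * (M a ^ d * M b ^ d))                   ≡⟨ cong (E *_) (^-distribʳ-*³ 9 (M a) (M b) d) ⟨
    E * (9 * (M a * M b)) ^ d                           ≡⟨ cong (λ x → E * x ^ d) 9*M*M≡8*M*M ⟩
    E * (8 * (M c * M e)) ^ d                           ≡⟨ cong (E *_) (^-distribʳ-* 8 (M c * M e) d) ⟩
    E * (8 ^ d * Y)                                     ≡⟨ *-assoc E (8 ^ d) Y ⟨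
    E * 8 ^ d * Y                                       ≡⟨ cong (_* Y) (*-comm E (8 ^ d)) ⟩
    8 ^ d * E * Y                                       <⟨ *-monoˡ-< Y {{Y≢0}} 8^d*2^a*2^b<9^d*k ⟩
    9 ^ d * k * Y                                       ≡⟨ *-assoc (9 ^ d) k Y ⟩
    9 ^ d * (k * Y)                                     ≤⟨ *-monoʳ-≤ (9 ^ d) lower ⟩
    9 ^ d * (q c * q e)                                 ∎)
    where
    open ≤-Reasoning
    E = 2 ^ a * 2 ^ b
    Y = (M c * M e) ^ d
    Y≢0 : NonZero Y
    Y≢0 = m^n≢0 (M c * M e) d {{>-nonZero (*-mono-≤ (M-pos c) (M-pos e))}}
    regroup : ∀ B P Q X Y → B * ((P * X) * (Q * Y)) ≡ (P * Q) * (B * (X * Y))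
    regroup = solve-∀

  q-logConcave-3+3m : ∀ m → let n = 3 + triple m in 8 ^ d * 4 ^ n < 9 ^ d → q (n ∸ 1) * q (suc n) < q n * q n
  q-logConcave-3+3m m 8^d*4^n<9^d = q*q<q*q (2 + t) (4 + t) n n 1
    (M*M-periodic {9} {8} 0 2 1 1 m refl)
    (subst₂ _<_ (cong (8 ^ d *_) (sym (2^k*2^[2+k]≡4^[1+k] (2 + t)))) (sym (*-identityʳ (9 ^ d))) 8^d*4^n<9^d)
    (≤-trans (≤-reflexive (trans (*-identityˡ _) (^-distribʳ-* (M n) (M n) d))) (*-mono-≤ (M^d≤q n) (M^d≤q n)))
    where
    t = triple m
    n = 3 + t

  q-logConvex-4+3m : ∀ m → let n = 4 + triple m in 8 ^ d * (3 * 4 ^ n) < 9 ^ d * (n + 2) → q n * q n < q (n ∸ 1) * q (suc n)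
  q-logConvex-4+3m m 8^d*3*4^n<9^d*[n+2] = q*q<q*q n n (3 + t) (5 + t) (2 + m)
    (M*M-periodic {9} {8} 2 2 1 3 m refl)
    (*-cancelˡ-< 3 _ _ (subst₂ _<_ lhs rhs 8^d*3*4^n<9^d*[n+2]))
    (begin
      (2 + m) * (M (3 + t) * M (5 + t)) ^ d         ≡⟨ cong ((2 + m) *_) (^-distribʳ-* (M (3 + t)) (M (5 + t)) d) ⟩
      (2 + m) * (M (3 + t) ^ d * M (5 + t) ^ d)     ≡⟨ x*[y*z]≡y*[x*z] (2 + m) (M (3 + t) ^ d) (M (5 + t) ^ d) ⟩
      M (3 + t) ^ d * ((2 + m) * M (5 + t) ^ d)     ≤⟨ *-mono-≤ (M^d≤q (3 + t)) (q-lower-2+3m (suc m)) ⟩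
      q (3 + t) * q (5 + t)                         ∎)
    where
    open ≤-Reasoning
    t = triple m
    n = 4 + t
    lhs : 8 ^ d * (3 * 4 ^ n) ≡ 3 * (8 ^ d * (2 ^ n * 2 ^ n))
    lhs = trans (x*[y*z]≡y*[x*z] (8 ^ d) 3 (4 ^ n)) (cong (λ x → 3 * (8 ^ d * x)) (^-distribʳ-* 2 2 n))
    4+3m+2≡3*[2+m] : ∀ m → 4 + 3 * m + 2 ≡ 3 * (2 + m)
    4+3m+2≡3*[2+m] = solve-∀
    rhs : 9 ^ d * (n + 2) ≡ 3 * (9 ^ d * (2 + m))
    rhs = trans (cong (λ x → 9 ^ d * (4 + x + 2)) (triple≡3* m))
                (trans (cong (9 ^ d *_) (4+3m+2≡3*[2+m] m)) (x*[y*z]≡y*[x*z] (9 ^ d) 3 (2 + m)))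

  q-logConcave-5+3m : ∀ m → let n = 5 + triple m in 8 ^ d * 2 ^ (n + 2) < 9 ^ d → q (n ∸ 1) * q (suc n) ≤ q n * q n
  q-logConcave-5+3m m 8^d*2^[n+2]<9^d = *-cancelˡ-≤ 16 (begin
    16 * (q (4 + t) * q (6 + t))                              ≡⟨ split (q (4 + t)) (q (6 + t)) ⟩
    (8 * q (4 + t)) * (2 * q (6 + t))                         ≤⟨ *-mono-≤ (≤[]-absorb 8 (q-≤[]-4+3m m) absorb₈)
                                                                          (≤[]-absorb 2 (q-≤[]-3+3m (suc m)) 8^d*2^[7+t]≤9^d) ⟩
    ((8 * count₁ m + 1) * P) * ((2 * 1 + 1) * Q)              ≡⟨ regroup (8 * count₁ m + 1) P Q ⟩
    (3 * (8 * count₁ m + 1)) * (P * Q)                        ≤⟨ *-monoˡ-≤ (P * Q) (count₁-bound m) ⟩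
    (16 * ((2 + m) * (2 + m))) * (P * Q)                      ≡⟨ cong (16 * ((2 + m) * (2 + m)) *_) X*X≡P*Q ⟨
    (16 * ((2 + m) * (2 + m))) * (X * X)                      ≡⟨ square (2 + m) X ⟩
    16 * (((2 + m) * X) * ((2 + m) * X))                      ≤⟨ *-monoʳ-≤ 16 (*-mono-≤ (q-lower-2+3m (suc m)) (q-lower-2+3m (suc m))) ⟩
    16 * (q (5 + t) * q (5 + t))                              ∎)
    where
    open ≤-Reasoning
    t = triple m
    P = M (4 + t) ^ d
    Q = M (6 + t) ^ d
    X = M (5 + t) ^ d
    8^d*2^[7+t]≤9^d : 8 ^ d * 2 ^ (7 + t) ≤ 9 ^ d
    8^d*2^[7+t]≤9^d = <⇒≤ (subst (λ k → 8 ^ d * 2 ^ k < 9 ^ d) (+-comm (5 + t) 2) 8^d*2^[n+2]<9^d)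
    8*x≡2*[2*[2*x]] : ∀ x → 8 * x ≡ 2 * (2 * (2 * x))
    8*x≡2*[2*[2*x]] = solve-∀
    absorb₈ : 8 ^ d * (8 * 2 ^ (4 + t)) ≤ 9 ^ d
    absorb₈ = subst (λ x → 8 ^ d * x ≤ 9 ^ d) (sym (8*x≡2*[2*[2*x]] (2 ^ (4 + t)))) 8^d*2^[7+t]≤9^d
    X*X≡P*Q : X * X ≡ P * Q
    X*X≡P*Q = begin-equality
      X * X                          ≡⟨ ^-distribʳ-* (M (5 + t)) (M (5 + t)) d ⟨
      (M (5 + t) * M (5 + t)) ^ d    ≡⟨ cong (_^ d) (*-cancelˡ-≡ _ _ 1 (M*M-periodic {1} {1} 3 3 2 4 m refl)) ⟩
      (M (4 + t) * M (6 + t)) ^ d    ≡⟨ ^-distribʳ-* (M (4 + t)) (M (6 + t)) d ⟩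
      P * Q                          ∎
    split : ∀ x y → 16 * (x * y) ≡ (8 * x) * (2 * y)
    split = solve-∀
    regroup : ∀ c P Q → (c * P) * ((2 * 1 + 1) * Q) ≡ (3 * c) * (P * Q)
    regroup = solve-∀
    square : ∀ k X → (16 * (k * k)) * (X * X) ≡ 16 * ((k * X) * (k * X))
    square = solve-∀

exceedsDψ-≡0 : ∀ {n d} → n % 3 ≡ 0 → exceedsDψ n d → 8 ^ d * 4 ^ n < 9 ^ d
exceedsDψ-≡0 {n} n%3≡0 exceeds with n ≟ 5
... | yes refl = contradiction n%3≡0 λ ()
... | no _ with n % 3
...   | 0     = exceeds
...   | suc _ = contradiction n%3≡0 λ ()

exceedsDψ-≡1 : ∀ {n d} → n % 3 ≡ 1 → exceedsDψ n d → 8 ^ d * (3 * 4 ^ n) < 9 ^ d * (n + 2)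
exceedsDψ-≡1 {n} n%3≡1 exceeds with n ≟ 5
... | yes refl = contradiction n%3≡1 λ ()
... | no _ with n % 3
...   | 0           = contradiction n%3≡1 λ ()
...   | 1           = exceeds
...   | suc (suc _) = contradiction n%3≡1 λ ()

-- For n = 5 the bound d > log_{9/8} 512 is stronger than the generic one, d > 7 log_{9/8} 2.
exceedsDψ-≡2 : ∀ {n d} → n % 3 ≡ 2 → exceedsDψ n d → 8 ^ d * 2 ^ (n + 2) < 9 ^ d
exceedsDψ-≡2 {n} {d} n%3≡2 exceeds with n ≟ 5
... | yes refl = ≤-trans (s≤s (*-monoʳ-≤ (8 ^ d) (by-computation {128} {512}))) exceeds
... | no _ with n % 3
...   | 0                 = contradiction n%3≡2 λ ()
...   | 1                 = contradiction n%3≡2 λ ()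
...   | 2                 = exceeds
...   | suc (suc (suc _)) = contradiction n%3≡2 λ ()

data Residue3 : ℕ → Set where
  ≡0 : ∀ m → Residue3 (3 + triple m)
  ≡1 : ∀ m → Residue3 (4 + triple m)
  ≡2 : ∀ m → Residue3 (5 + triple m)

residue3 : ∀ n → 3 ≤ n → Residue3 n
residue3 1 (s≤s ())
residue3 2 (s≤s (s≤s ()))
residue3 3 _ = ≡0 0
residue3 4 _ = ≡1 0
residue3 5 _ = ≡2 0
residue3 (suc (suc (suc n@(suc (suc (suc _)))))) _ with residue3 n (s≤s (s≤s (s≤s z≤n)))
... | ≡0 m = ≡0 (suc m)
... | ≡1 m = ≡1 (suc m)
... | ≡2 m = ≡2 (suc m)

corollary1 : (n d : ℕ) → 3 ≤ n → exceedsDψ n d →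
    ((qψ d n * qψ d n < qψ d (n ∸ 1) * qψ d (suc n)) ⇔ (n % 3 ≡ 1))
corollary1 n d 3≤n exceeds with residue3 n 3≤n
... | ≡0 m = mk⇔ (λ q²<q₋q₊ → contradiction q²<q₋q₊ (<-asym (q-logConcave-3+3m m (exceedsDψ-≡0 n%3≡0 exceeds))))
                 (λ n%3≡1 → contradiction (trans (sym n%3≡0) n%3≡1) λ ())
  where
  open Estimates d
  n%3≡0 : (3 + triple m) % 3 ≡ 0
  n%3≡0 = [r+triple]%3≡r%3 3 m
... | ≡1 m = mk⇔ (λ _ → n%3≡1) (λ _ → q-logConvex-4+3m m (exceedsDψ-≡1 n%3≡1 exceeds))
  where
  open Estimates d
  n%3≡1 : (4 + triple m) % 3 ≡ 1
  n%3≡1 = [r+triple]%3≡r%3 4 m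
... | ≡2 m = mk⇔ (λ q²<q₋q₊ → contradiction q²<q₋q₊ (≤⇒≯ (q-logConcave-5+3m m (exceedsDψ-≡2 n%3≡2 exceeds))))
                 (λ n%3≡1 → contradiction (trans (sym n%3≡2) n%3≡1) λ ())
  where
  open Estimates d
  n%3≡2 : (5 + triple m) % 3 ≡ 2
  n%3≡2 = [r+triple]%3≡r%3 5 m
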